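{- Let $n\ge 0$ and let $f_n$ be the leaf-Fibonacci tree of size $n$. For every leaf-induced subtree $S$ of $f_n$ with at least two leaves, there is a set $L'$ of leaves of $f_n$ such that the minimal subtree of $f_n$ containing $L'$ contains the root of $f_n$ and the subtree of $f_n$ induced by $L'$ is isomorphic (as a rooted tree) to $S$. In other words, up to isomorphism, every leaf-induced subtree of $f_n$ with two or more leaves can be realized as a leaf-induced subtree containing the root of $f_n$.
   Context: A topological tree is a rooted tree with no vertex of outdegree $1$. The leaf-Fibonacci trees are defined recursively: $f_0$ is the tree with a single vertex; $f_1$ is the tree consisting of a root with two leaves attached; for $n\ge 2$, $f_n$ is obtained by joining the roots of $f_{n-1}$ and $f_{n-2}$ to a new common root vertex (so $f_n$ is the binary tree whose two root branches are $f_{n-1}$ and $f_{n-2}$). For a topological tree $T$ and a nonempty set $L$ of leaves of $T$, the subtree induced by $L$ is obtained by taking the minimal subtree of $T$ containing all leaves in $L$ (rooted at its vertex closest to the root of $T$) and suppressing all vertices of outdegree $1$; such trees are called leaf-induced subtrees of $T$. Two rooted trees are isomorphic if there is a graph isomorphism between them mapping root to root. -}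

module Defs where

open import Data.Nat using (ℕ; zero; suc; _+_)
open import Data.Bool using (Bool; true; false)
open import Data.Unit using (⊤; tt)
open import Data.Sum using (_⊎_; inj₁; inj₂)
open import Data.Product using (_×_; Σ)
open import Data.Maybe using (Maybe; just; nothing)
open import Relation.Binary.PropositionalEquality using (_≡_)

-- Binary rooted trees (every internal vertex has outdegree exactly 2).
-- Leaf-Fibonacci trees and all their leaf-induced subtrees are of this form.
data BTree : Set where
  leaf : BTree
  node : BTree → BTree → BTree

fib : ℕ → BTree
fib zero = leaf
fib (suc zero) = node leaf leaf
fib (suc (suc n)) = node (fib (suc n)) (fib n)

leaves : BTree → ℕ
leaves leaf = 1
leaves (node l r) = leaves l + leaves r

Leaf : BTree → Set
Leaf leaf = ⊤
Leaf (node l r) = Leaf l ⊎ Leaf r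

LeafSet : BTree → Set
LeafSet t = Leaf t → Bool

-- Subtree induced by a leaf set: minimal subtree containing the chosen leaves,
-- rooted at its vertex closest to the root, with outdegree-1 vertices suppressed.
-- Returns nothing iff the leaf set is empty.
combine : Maybe BTree → Maybe BTree → Maybe BTree
combine (just a) (just b) = just (node a b)
combine (just a) nothing = just a
combine nothing (just b) = just b
combine nothing nothing = nothing

induced : (t : BTree) → LeafSet t → Maybe BTree
induced leaf s with s tt
... | true = just leaf
... | false = nothing
induced (node l r) s =
  combine (induced l (λ p → s (inj₁ p))) (induced r (λ p → s (inj₂ p)))

-- The minimal subtree of t containing the leaves of L contains the root of t.
-- For a single-vertex tree: L contains that vertex.  Otherwise the root lies in
-- the minimal subtree iff it lies on the path between two chosen leaves, i.e.
-- iff L has a leaf in each of the two root branches.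
SpanContainsRoot : (t : BTree) → LeafSet t → Set
SpanContainsRoot leaf s = s tt ≡ true
SpanContainsRoot (node l r) s =
  Σ (Leaf l) (λ p → s (inj₁ p) ≡ true) × Σ (Leaf r) (λ q → s (inj₂ q) ≡ true)

data _≅_ : BTree → BTree → Set where
  leaf≅ : leaf ≅ leaf
  straight : ∀ {a b c d} → a ≅ c → b ≅ d → node a b ≅ node c d
  swapped  : ∀ {a b c d} → a ≅ d → b ≅ c → node a b ≅ node c d

module Submission where

-- The leaf-induced subtrees of node X Y whose span contains the root are exactly
-- the trees node A B with A, B leaf-induced in X, Y.  Every leaf-induced subtree of
-- f_m is also one of f_(m+1) (f_m is its left branch), so root-containing induced
-- subtrees of f_(k+1) = node f_k f_(k-1) transfer to f_(k+2) = node f_(k+1) f_k.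
-- An induced subtree of f_(k+2) with two or more leaves either uses both branches,
-- or lies inside f_(k+1) or inside f_k, hence inside f_(k+1), where induction on n
-- applies.  The realization is exact, not merely up to isomorphism.

open import Defs
open import Data.Nat using (ℕ; _≤_; zero; suc; s≤s)
open import Data.Product using (Σ; _×_; _,_; map)
open import Data.Maybe using (Maybe; just; nothing)
open import Data.Maybe.Properties using (just-injective)
open import Data.Bool using (true; false)
open import Data.Unit using (tt)
open import Data.Sum using (_⊎_; inj₁; inj₂)
open import Data.Empty using (⊥-elim)
open import Function using (_∘_; const; id)
open import Relation.Nullary using (¬_)
open import Relation.Binary.PropositionalEquality using (_≡_; refl; sym; trans; cong₂)

≅-refl : (t : BTree) → t ≅ t
≅-refl leaf = leaf≅
≅-refl (node a b) = straight (≅-refl a) (≅-refl b)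

Induced : BTree → BTree → Set
Induced t S = Σ (LeafSet t) (λ s → induced t s ≡ just S)

RootInduced : BTree → BTree → Set
RootInduced t S = Σ (LeafSet t) (λ s → SpanContainsRoot t s × induced t s ≡ just S)

Joined : BTree → BTree → BTree → Set
Joined X Y S = Σ BTree (λ A → Σ BTree (λ B → Induced X A × Induced Y B × S ≡ node A B))

combine-justˡ : (A : BTree) (y : Maybe BTree) → Σ BTree (λ S → combine (just A) y ≡ just S)
combine-justˡ A (just B) = node A B , refl
combine-justˡ A nothing = A , refl

combine-justʳ : (x : Maybe BTree) (B : BTree) → Σ BTree (λ S → combine x (just B) ≡ just S)
combine-justʳ (just A) B = node A B , refl
combine-justʳ nothing B = B , refl

induced-empty : (t : BTree) → induced t (const false) ≡ nothing
induced-empty leaf = refl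
induced-empty (node l r) rewrite induced-empty l | induced-empty r = refl

induced⇒marked : (t : BTree) (s : LeafSet t) {S : BTree} →
  induced t s ≡ just S → Σ (Leaf t) (λ p → s p ≡ true)
induced⇒marked leaf s e with s tt in eq
induced⇒marked leaf s e  | true = tt , eq
induced⇒marked leaf s () | false
induced⇒marked (node l r) s e with induced l (s ∘ inj₁) in eˡ | induced r (s ∘ inj₂) in eʳ
induced⇒marked (node l r) s e  | just _  | _ = map inj₁ id (induced⇒marked l (s ∘ inj₁) eˡ)
induced⇒marked (node l r) s e  | nothing | just _ = map inj₂ id (induced⇒marked r (s ∘ inj₂) eʳ)
induced⇒marked (node l r) s () | nothing | nothing

marked⇒induced : (t : BTree) (s : LeafSet t) (p : Leaf t) →
  s p ≡ true → Σ BTree (λ S → induced t s ≡ just S)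
marked⇒induced leaf s tt e rewrite e = leaf , refl
marked⇒induced (node l r) s (inj₁ p) e with marked⇒induced l (s ∘ inj₁) p e
... | A , eA rewrite eA = combine-justˡ A (induced r (s ∘ inj₂))
marked⇒induced (node l r) s (inj₂ q) e with marked⇒induced r (s ∘ inj₂) q e
... | B , eB rewrite eB = combine-justʳ (induced l (s ∘ inj₁)) B

induced-leaf : {S : BTree} → Induced leaf S → S ≡ leaf
induced-leaf (s , e) with s tt
induced-leaf (s , refl) | true = refl
induced-leaf (s , ())   | false

induced-node-cases : (X Y : BTree) {S : BTree} →
  Induced (node X Y) S → Joined X Y S ⊎ Induced X S ⊎ Induced Y S
induced-node-cases X Y (s , e) with induced X (s ∘ inj₁) in eˡ | induced Y (s ∘ inj₂) in eʳ
induced-node-cases X Y (s , refl) | just A  | just B  = inj₁ (A , B , (_ , eˡ) , (_ , eʳ) , refl)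
induced-node-cases X Y (s , refl) | just A  | nothing = inj₂ (inj₁ (_ , eˡ))
induced-node-cases X Y (s , refl) | nothing | just B  = inj₂ (inj₂ (_ , eʳ))
induced-node-cases X Y (s , ())   | nothing | nothing

joined⇒rootInduced : (X Y : BTree) {S : BTree} → Joined X Y S → RootInduced (node X Y) S
joined⇒rootInduced X Y (A , B , (sˡ , eˡ) , (sʳ , eʳ) , refl) =
  s , (induced⇒marked X sˡ eˡ , induced⇒marked Y sʳ eʳ) , cong₂ combine eˡ eʳ
  where
  s : LeafSet (node X Y)
  s (inj₁ p) = sˡ p
  s (inj₂ q) = sʳ q

rootInduced⇒joined : (X Y : BTree) {S : BTree} → RootInduced (node X Y) S → Joined X Y S
rootInduced⇒joined X Y (s , ((p , ep) , (q , eq)) , e)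
  with marked⇒induced X (s ∘ inj₁) p ep | marked⇒induced Y (s ∘ inj₂) q eq
... | A , eA | B , eB =
  A , B , (_ , eA) , (_ , eB) , just-injective (trans (sym e) (cong₂ combine eA eB))

infix 4 _⊑_
_⊑_ : BTree → BTree → Set
t ⊑ u = ∀ {S} → Induced t S → Induced u S

⊑-refl : {t : BTree} → t ⊑ t
⊑-refl i = i

⊑-nodeˡ : (l r : BTree) → l ⊑ node l r
⊑-nodeˡ l r (s , e) = s′ , cong₂ combine e (induced-empty r)
  where
  s′ : LeafSet (node l r)
  s′ (inj₁ p) = s p
  s′ (inj₂ _) = false

fib-⊑-suc : (m : ℕ) → fib m ⊑ fib (suc m)
fib-⊑-suc zero = ⊑-nodeˡ leaf leaf
fib-⊑-suc (suc m) = ⊑-nodeˡ (fib (suc m)) (fib m)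

rootInduced-mono : {X Y X′ Y′ : BTree} → X ⊑ X′ → Y ⊑ Y′ →
  ∀ {S} → RootInduced (node X Y) S → RootInduced (node X′ Y′) S
rootInduced-mono {X} {Y} {X′} {Y′} X⊑X′ Y⊑Y′ r with rootInduced⇒joined X Y r
... | A , B , iA , iB , e = joined⇒rootInduced X′ Y′ (A , B , X⊑X′ iA , Y⊑Y′ iB , e)

rootInduced-fib-suc : (k : ℕ) {S : BTree} →
  RootInduced (fib (suc k)) S → RootInduced (fib (suc (suc k))) S
rootInduced-fib-suc zero = rootInduced-mono (fib-⊑-suc 0) ⊑-refl
rootInduced-fib-suc (suc k) = rootInduced-mono (fib-⊑-suc (suc k)) (fib-⊑-suc k)

induced-leaf-small : {S : BTree} → Induced leaf S → ¬ (2 ≤ leaves S)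
induced-leaf-small i le with induced-leaf i
induced-leaf-small i (s≤s ()) | refl

Rootable : BTree → Set
Rootable t = ∀ {S} → Induced t S → 2 ≤ leaves S → RootInduced t S

rootable-fib-step : (k : ℕ) → Rootable (fib (suc k)) → Rootable (fib (suc (suc k)))
rootable-fib-step k ih i le with induced-node-cases (fib (suc k)) (fib k) i
... | inj₁ j        = joined⇒rootInduced (fib (suc k)) (fib k) j
... | inj₂ (inj₁ x) = rootInduced-fib-suc k (ih x le)
... | inj₂ (inj₂ x) = rootInduced-fib-suc k (ih (fib-⊑-suc k x) le)

rootable-fib : (n : ℕ) → Rootable (fib n)
rootable-fib zero i le = ⊥-elim (induced-leaf-small i le)
rootable-fib (suc zero) i le with induced-node-cases leaf leaf i
... | inj₁ j        = joined⇒rootInduced leaf leaf j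
... | inj₂ (inj₁ x) = ⊥-elim (induced-leaf-small x le)
... | inj₂ (inj₂ x) = ⊥-elim (induced-leaf-small x le)
rootable-fib (suc (suc k)) = rootable-fib-step k (rootable-fib (suc k))

mainTheorem1 : (n : ℕ) (L : LeafSet (fib n)) (S : BTree) →
    induced (fib n) L ≡ just S → 2 ≤ leaves S →
    Σ (LeafSet (fib n)) (λ L' → SpanContainsRoot (fib n) L' ×
      Σ BTree (λ S' → (induced (fib n) L' ≡ just S') × (S' ≅ S)))
mainTheorem1 n L S e le with rootable-fib n (L , e) le
... | L' , root , e' = L' , root , S , e' , ≅-refl S
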